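{- Suppose $b_1,b_2,b_3\in\Omega$ satisfy $b_i\sim a_i$ for $i=1,2,3$ and $b_1b_2b_3=\mathrm{id}$. Then there exist $\beta\in\Omega$ and $g_1,g_2,g_3\in G$ such that $b_i=\beta\,g_ia_ig_i^{ -1}\beta^{ -1}$ for all $i=1,2,3$. In particular, the closed subgroups of $\Omega$ topologically generated by $a_1,a_2,a_3$ and by $b_1,b_2,b_3$ are conjugate in $\Omega$.
   Context: Let $T$ be the infinite regular rooted binary tree whose vertices are finite words over $\{1,2\}$, and $\Omega=\mathrm{Aut}(T)$ with its profinite topology. Every element of $\Omega$ is written $(u,v)\tau$ with $u,v\in\Omega$ (the actions on the subtrees rooted at $1$ and $2$) and $\tau\in S_2=\{\mathrm{id},\sigma\}$, where $\sigma=(\mathrm{id},\mathrm{id})\sigma$ swaps the two subtrees; multiplication is $(x_1,x_2)\tau(y_1,y_2)\tau'=(x_1y_{\tau(1)},x_2y_{\tau(2)})\tau\tau'$. Let $a_1,a_2,a_3\in\Omega$ be the unique elements satisfying the recursions $a_1=\sigma$, $a_2=(a_3^{ -1},a_2^{ -1})\sigma$, $a_3=(a_2,a_3)$ (so $a_1a_2a_3=\mathrm{id}$). Let $G$ be the closed subgroup of $\Omega$ topologically generated by $a_1,a_2,a_3$. The symbol $\sim$ denotes conjugacy in $\Omega$. -}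

module Defs where

open import Data.Bool using (Bool; true; false; _xor_)
open import Data.List using (List; []; _∷_; length)
open import Data.Nat using (ℕ; _<_)
open import Data.Fin using (Fin; zero; suc)
open import Data.Product using (_×_; _,_; ∃)
open import Relation.Binary.PropositionalEquality using (_≡_)

-- Vertices of the binary tree: finite words over {1,2}; letter 1 = false, 2 = true.
Vertex : Set
Vertex = List Bool

-- An automorphism of T, given by its portrait: at each vertex, whether it
-- swaps the two subtrees below that vertex (true = σ, false = id).
-- Every automorphism is uniquely determined by its portrait.
Ω : Set
Ω = Vertex → Bool

infix 4 _≈_
_≈_ : Ω → Ω → Set
g ≈ h = ∀ v → g v ≡ h v

sect : Ω → Bool → Ω
sect g x w = g (x ∷ w)

act : Ω → Vertex → Vertex
act g []      = []
act g (x ∷ w) = (g [] xor x) ∷ act (sect g x) w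

actInv : Ω → Vertex → Vertex
actInv g []      = []
actInv g (y ∷ w) = (g [] xor y) ∷ actInv (sect g (g [] xor y)) w

e : Ω
e _ = false

σ : Ω
σ []      = true
σ (_ ∷ _) = false

⟨_,_⟩_ : Ω → Ω → Bool → Ω
(⟨ u , v ⟩ τ) []          = τ
(⟨ u , v ⟩ τ) (false ∷ w) = u w
(⟨ u , v ⟩ τ) (true ∷ w)  = v w

-- product with the paper's convention (right actions: first g, then h), so that
-- (x1,x2)τ (y1,y2)τ' = (x1 y_τ(1), x2 y_τ(2)) ττ'
infixl 7 _·_
_·_ : Ω → Ω → Ω
(g · h) v = g v xor h (act g v)

_⁻¹ : Ω → Ω
(g ⁻¹) v = g (actInv g v)

infix 4 _∼_
_∼_ : Ω → Ω → Set
b ∼ a = ∃ λ c → b ≈ c · a · c ⁻¹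

-- group words in three generators: (i , false) = generator i, (i , true) = its inverse
Word : Set
Word = List (Fin 3 × Bool)

evalWord : (Fin 3 → Ω) → Word → Ω
evalWord gens []               = e
evalWord gens ((i , false) ∷ w) = gens i · evalWord gens w
evalWord gens ((i , true) ∷ w)  = (gens i ⁻¹) · evalWord gens w

-- x lies in the closed subgroup of Ω topologically generated by gens:
-- every basic neighbourhood of x (automorphisms agreeing with x on the
-- first n levels) meets the abstract subgroup generated by gens.
InClosedSubgroup : (Fin 3 → Ω) → Ω → Set
InClosedSubgroup gens x =
  ∀ (n : ℕ) → ∃ λ (w : Word) → ∀ (v : Vertex) → length v < n → evalWord gens w v ≡ x v

triple : Ω → Ω → Ω → Fin 3 → Ω
triple x y z zero             = x
triple x y z (suc zero)       = y
triple x y z (suc (suc zero)) = z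

{-# OPTIONS --safe #-}
-- Write bᵢ = cᵢ aᵢ cᵢ⁻¹. Conjugating the triple by C = c₁ σ^t, with t ∈ {0,1} chosen so that
-- C⁻¹c₃ fixes the first level, turns it into b₁ = σ, b₂ = (p , q)σ, b₃ = (B₂ , B₃), where
-- b₁b₂b₃ = 1 forces p = B₃⁻¹ and q = B₂⁻¹. Reading the conjugacies off the first-level sections
-- (using a₂ = (a₃⁻¹ , a₂⁻¹)σ, a₃ = (a₂ , a₃) and a₃⁻¹a₂⁻¹ = a₁) shows that (pq , B₂ , B₃) is again
-- such a triple. If X conjugates (a₁ , a₂ , a₃) to it on n levels, then C (X , X) conjugates
-- (a₁ , a₂ , a₃) to (b₁ , b₂ , b₃) on n + 1 levels. The approximate conjugators obtained this way
-- are compatible, and their limit β conjugates every aᵢ to bᵢ at once, so g₁ = g₂ = g₃ = 1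
-- already works, and conjugation by β carries one closed subgroup onto the other.
module Submission where

open import Algebra.Bundles using (Group)
import Algebra.Properties.Group
open import Data.Bool using (Bool; true; false; not; _xor_)
open import Data.Bool.Properties using (xor-assoc; xor-comm; xor-identityʳ; xor-same)
open import Data.Fin using (Fin; zero; suc; #_)
open import Data.List using ([]; _∷_; length)
open import Data.Nat using (ℕ; zero; suc; _≤_; _<_; z≤n; s≤s)
open import Data.Nat.Properties using (≤-refl)
open import Data.Product using (_×_; _,_; ∃)
open import Function.Bundles using (_⇔_; mk⇔)
open import Level using (0ℓ)
open import Relation.Binary.PropositionalEquality as ≡ using (_≡_; refl; cong; cong₂)
import Relation.Binary.Reasoning.Setoid as SetoidReasoning

module Intertwining {o ℓ} (G : Group o ℓ) where

  open Group G
  open import Algebra.Properties.Group G using (x≈z//y; ∙-cancelˡ; ∙-cancelʳ)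
  open import Algebra.Properties.Monoid monoid using (cancelˡ; cancelʳ; insertˡ; insertʳ; ε-comm)
  open SetoidReasoning setoid

  private
    variable
      a a′ b b′ c d x : Carrier

  -- A record rather than the bare equation so that b, c and a can be inferred from a proof:
  -- in Ω an equation between products does not determine the factors.
  record Intertwines (b c a : Carrier) : Set ℓ where
    constructor intertwines
    field
      equation : b ∙ c ≈ c ∙ a

  open Intertwines public

  intertwines⇒conjugate : Intertwines b c a → b ≈ c ∙ a ∙ c ⁻¹
  intertwines⇒conjugate {b} {c} {a} (intertwines bc≈ca) = x≈z//y b c (c ∙ a) bc≈ca

  conjugate⇒intertwines : b ≈ c ∙ a ∙ c ⁻¹ → Intertwines b c a
  conjugate⇒intertwines {b} {c} {a} b≈cac⁻¹ =
    intertwines (trans (∙-congʳ b≈cac⁻¹) (cancelʳ (inverseˡ c) (c ∙ a)))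

  intertwines-conj : ∀ b c → Intertwines b c (c ⁻¹ ∙ b ∙ c)
  intertwines-conj b c = intertwines (begin
    b ∙ c                ≈⟨ ∙-congʳ (cancelˡ (inverseʳ c) b) ⟨
    c ∙ (c ⁻¹ ∙ b) ∙ c   ≈⟨ assoc c (c ⁻¹ ∙ b) c ⟩
    c ∙ (c ⁻¹ ∙ b ∙ c)   ∎)

  intertwines-sym : Intertwines b c a → Intertwines a (c ⁻¹) b
  intertwines-sym {b} {c} {a} bc≈ca = intertwines (begin
    a ∙ c ⁻¹                  ≈⟨ insertˡ (inverseˡ c) (a ∙ c ⁻¹) ⟩
    c ⁻¹ ∙ (c ∙ (a ∙ c ⁻¹))   ≈⟨ ∙-congˡ (assoc c a (c ⁻¹)) ⟨
    c ⁻¹ ∙ (c ∙ a ∙ c ⁻¹)     ≈⟨ ∙-congˡ (intertwines⇒conjugate bc≈ca) ⟨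
    c ⁻¹ ∙ b                  ∎)

  intertwines-trans : Intertwines b c a → Intertwines a d x → Intertwines b (c ∙ d) x
  intertwines-trans {b} {c} {a} {d} {x} (intertwines bc≈ca) (intertwines ad≈dx) = intertwines (begin
    b ∙ (c ∙ d)   ≈⟨ assoc b c d ⟨
    b ∙ c ∙ d     ≈⟨ ∙-congʳ bc≈ca ⟩
    c ∙ a ∙ d     ≈⟨ assoc c a d ⟩
    c ∙ (a ∙ d)   ≈⟨ ∙-congˡ ad≈dx ⟩
    c ∙ (d ∙ x)   ≈⟨ assoc c d x ⟨
    c ∙ d ∙ x     ∎)

  intertwines-∙ : Intertwines b c a → Intertwines b′ c a′ → Intertwines (b ∙ b′) c (a ∙ a′)
  intertwines-∙ {b} {c} {a} {b′} {a′} (intertwines bc≈ca) (intertwines b′c≈ca′) = intertwines (begin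
    b ∙ b′ ∙ c     ≈⟨ assoc b b′ c ⟩
    b ∙ (b′ ∙ c)   ≈⟨ ∙-congˡ b′c≈ca′ ⟩
    b ∙ (c ∙ a′)   ≈⟨ assoc b c a′ ⟨
    b ∙ c ∙ a′     ≈⟨ ∙-congʳ bc≈ca ⟩
    c ∙ a ∙ a′     ≈⟨ assoc c a a′ ⟩
    c ∙ (a ∙ a′)   ∎)

  intertwines-⁻¹ : Intertwines b c a → Intertwines (b ⁻¹) c (a ⁻¹)
  intertwines-⁻¹ {b} {c} {a} (intertwines bc≈ca) = intertwines (begin
    b ⁻¹ ∙ c               ≈⟨ insertʳ (inverseʳ a) (b ⁻¹ ∙ c) ⟩
    b ⁻¹ ∙ c ∙ a ∙ a ⁻¹    ≈⟨ ∙-congʳ (assoc (b ⁻¹) c a) ⟩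
    b ⁻¹ ∙ (c ∙ a) ∙ a ⁻¹  ≈⟨ ∙-congʳ (∙-congˡ bc≈ca) ⟨
    b ⁻¹ ∙ (b ∙ c) ∙ a ⁻¹  ≈⟨ ∙-congʳ (cancelˡ (inverseˡ b) c) ⟩
    c ∙ a ⁻¹               ∎)

  intertwines-ε : ∀ c → Intertwines ε c ε
  intertwines-ε c = intertwines (sym (ε-comm c))

  intertwines-refl : ∀ b → Intertwines b ε b
  intertwines-refl b = intertwines (trans (identityʳ b) (sym (identityˡ b)))

  intertwines-swap : ∀ x y → Intertwines (x ∙ y) x (y ∙ x)
  intertwines-swap x y = intertwines (assoc x y x)

  intertwines-respˡ : b ≈ b′ → Intertwines b c a → Intertwines b′ c a
  intertwines-respˡ b≈b′ (intertwines bc≈ca) = intertwines (trans (∙-congʳ (sym b≈b′)) bc≈ca)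

  intertwines-respᶜ : c ≈ d → Intertwines b c a → Intertwines b d a
  intertwines-respᶜ c≈d (intertwines bc≈ca) =
    intertwines (trans (∙-congˡ (sym c≈d)) (trans bc≈ca (∙-congʳ c≈d)))

  intertwines-respʳ : a ≈ a′ → Intertwines b c a → Intertwines b c a′
  intertwines-respʳ a≈a′ (intertwines bc≈ca) = intertwines (trans bc≈ca (∙-congˡ a≈a′))

  intertwines-uniqueˡ : Intertwines b c a → Intertwines b′ c a → b ≈ b′
  intertwines-uniqueˡ {b} {c} {a} {b′} (intertwines bc≈ca) (intertwines b′c≈ca) =
    ∙-cancelʳ c b b′ (trans bc≈ca (sym b′c≈ca))

  intertwines-uniqueʳ : Intertwines b c a → Intertwines b c a′ → a ≈ a′
  intertwines-uniqueʳ {b} {c} {a} {a′} (intertwines bc≈ca) (intertwines bc≈ca′) =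
    ∙-cancelˡ c a a′ (trans (sym bc≈ca) bc≈ca′)

-- Opened only after the generic part, whose _≈_ and _⁻¹ would otherwise clash with these.
open import Defs

private
  variable
    n : ℕ
    g g′ h h′ : Ω
    τ : Bool

xor-involutive : ∀ x y → x xor (x xor y) ≡ y
xor-involutive x y = ≡.trans (≡.sym (xor-assoc x x y)) (cong (_xor y) (xor-same x))

xor-cancel : ∀ x y z → x xor y ≡ y xor z → x ≡ z
xor-cancel x y z eq = begin
  x                 ≡⟨ xor-involutive y x ⟨
  y xor (y xor x)   ≡⟨ cong (y xor_) (xor-comm y x) ⟩
  y xor (x xor y)   ≡⟨ cong (y xor_) eq ⟩
  y xor (y xor z)   ≡⟨ xor-involutive y z ⟩
  z                 ∎
  where open ≡.≡-Reasoning

infix 4 _≈[_]_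

data _≈[_]_ : Ω → ℕ → Ω → Set where
  leaf : g ≈[ zero ] h
  node : g [] ≡ h [] → (∀ x → sect g x ≈[ n ] sect h x) → g ≈[ suc n ] h

≈[]-root : g ≈[ suc n ] h → g [] ≡ h []
≈[]-root (node r _) = r

≈[]-sect : g ≈[ suc n ] h → ∀ x → sect g x ≈[ n ] sect h x
≈[]-sect (node _ s) = s

≈⇒≈[] : g ≈ h → g ≈[ n ] h
≈⇒≈[] {n = zero}  g≈h = leaf
≈⇒≈[] {n = suc n} g≈h = node (g≈h []) (λ x → ≈⇒≈[] (λ w → g≈h (x ∷ w)))

≈[]⇒pointwise : g ≈[ n ] h → ∀ v → length v < n → g v ≡ h v
≈[]⇒pointwise (node r _) []      _           = r
≈[]⇒pointwise (node _ s) (x ∷ w) (s≤s |w|<n) = ≈[]⇒pointwise (s x) w |w|<n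

pointwise⇒≈[] : (∀ v → length v < n → g v ≡ h v) → g ≈[ n ] h
pointwise⇒≈[] {n = zero}  g≡h = leaf
pointwise⇒≈[] {n = suc n} g≡h =
  node (g≡h [] (s≤s z≤n)) (λ x → pointwise⇒≈[] (λ w |w|<n → g≡h (x ∷ w) (s≤s |w|<n)))

≈[]⇒≈ : (∀ {n} → g ≈[ n ] h) → g ≈ h
≈[]⇒≈ g≈h v = ≈[]⇒pointwise g≈h v ≤-refl

≈[]-refl : g ≈[ n ] g
≈[]-refl = ≈⇒≈[] (λ _ → refl)

≈[]-reflexive : g ≡ h → g ≈[ n ] h
≈[]-reflexive refl = ≈[]-refl

≈[]-sym : g ≈[ n ] h → h ≈[ n ] g
≈[]-sym leaf       = leaf
≈[]-sym (node r s) = node (≡.sym r) (λ x → ≈[]-sym (s x))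

≈[]-trans : g ≈[ n ] g′ → g′ ≈[ n ] h → g ≈[ n ] h
≈[]-trans leaf       leaf         = leaf
≈[]-trans (node r s) (node r′ s′) = node (≡.trans r r′) (λ x → ≈[]-trans (s x) (s′ x))

·-cong : g ≈[ n ] g′ → h ≈[ n ] h′ → g · h ≈[ n ] g′ · h′
·-cong leaf leaf = leaf
·-cong {g = g} {h′ = h′} (node r s) (node r′ s′) = node (cong₂ _xor_ r r′) (λ x →
  ·-cong (s x) (≈[]-trans (s′ (g [] xor x)) (≈[]-reflexive (cong (λ y → sect h′ (y xor x)) r))))

·-congˡ : ∀ g → h ≈[ n ] h′ → g · h ≈[ n ] g · h′
·-congˡ g = ·-cong (≈[]-refl {g = g})

·-congʳ : ∀ h → g ≈[ n ] g′ → g · h ≈[ n ] g′ · h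
·-congʳ h g≈g′ = ·-cong g≈g′ (≈[]-refl {g = h})

⁻¹-cong : g ≈[ n ] g′ → g ⁻¹ ≈[ n ] g′ ⁻¹
⁻¹-cong leaf = leaf
⁻¹-cong {g = g} {g′ = g′} (node r s) = node r (λ x →
  ⁻¹-cong (≈[]-trans (s (g [] xor x)) (≈[]-reflexive (cong (λ y → sect g′ (y xor x)) r))))

·-assoc : ∀ g h k → (g · h) · k ≈[ n ] g · (h · k)
·-assoc {zero}  g h k = leaf
·-assoc {suc n} g h k = node (xor-assoc (g []) (h []) (k [])) (λ x →
  ≈[]-trans (·-assoc (sect g x) (sect h (g [] xor x)) (sect k ((g [] xor h []) xor x)))
            (·-congˡ (sect g x) (·-congˡ (sect h (g [] xor x))
              (≈[]-reflexive (cong (sect k) (shuffle (g []) (h []) x))))))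
  where
  shuffle : ∀ x y z → (x xor y) xor z ≡ y xor (x xor z)
  shuffle x y z = ≡.trans (cong (_xor z) (xor-comm x y)) (xor-assoc y x z)

·-identityˡ : ∀ g → e · g ≈[ n ] g
·-identityˡ {zero}  g = leaf
·-identityˡ {suc n} g = node refl (λ x → ·-identityˡ (sect g x))

·-identityʳ : ∀ g → g · e ≈[ n ] g
·-identityʳ {zero}  g = leaf
·-identityʳ {suc n} g = node (xor-identityʳ (g [])) (λ x → ·-identityʳ (sect g x))

⁻¹-inverseˡ : ∀ g → g ⁻¹ · g ≈[ n ] e
⁻¹-inverseˡ {zero}  g = leaf
⁻¹-inverseˡ {suc n} g = node (xor-same (g [])) (λ x → ⁻¹-inverseˡ (sect g (g [] xor x)))

⁻¹-inverseʳ : ∀ g → g · g ⁻¹ ≈[ n ] e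
⁻¹-inverseʳ {zero}  g = leaf
⁻¹-inverseʳ {suc n} g = node (xor-same (g [])) (λ x →
  ≈[]-trans (·-congˡ (sect g x) (⁻¹-cong (≈[]-reflexive (cong (sect g) (xor-involutive (g []) x)))))
            (⁻¹-inverseʳ (sect g x)))

Ω-group : ℕ → Group 0ℓ 0ℓ
Ω-group n = record
  { Carrier = Ω
  ; _≈_     = _≈[ n ]_
  ; _∙_     = _·_
  ; ε       = e
  ; _⁻¹     = _⁻¹
  ; isGroup = record
    { isMonoid = record
      { isSemigroup = record
        { isMagma = record
          { isEquivalence = record { refl = ≈[]-refl ; sym = ≈[]-sym ; trans = ≈[]-trans }
          ; ∙-cong        = ·-cong
          }
        ; assoc = ·-assoc
        }
      ; identity = ·-identityˡ , ·-identityʳ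
      }
    ; inverse = ⁻¹-inverseˡ , ⁻¹-inverseʳ
    ; ⁻¹-cong = ⁻¹-cong
    }
  }

module ≈[]-Reasoning (n : ℕ) = SetoidReasoning (Group.setoid (Ω-group n))

module ΩGroupProperties {n : ℕ} = Algebra.Properties.Group (Ω-group n)
open ΩGroupProperties using (inverseˡ-unique; ⁻¹-anti-homo-∙)

module ΩIntertwining {n : ℕ} = Intertwining (Ω-group n)
open ΩIntertwining

Intertwines[_] : ℕ → Ω → Ω → Ω → Set
Intertwines[ n ] = Intertwines {n}

sect-· : ∀ g h → g [] ≡ τ → ∀ x → sect (g · h) x ≈[ n ] sect g x · sect h (τ xor x)
sect-· g h refl x = ≈[]-refl

intertwines-root : ∀ {b c a} → Intertwines[ 1 ] b c a → b [] ≡ a []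
intertwines-root {b} {c} {a} (intertwines bc≈ca) = xor-cancel (b []) (c []) (a []) (≈[]-root bc≈ca)

sect-intertwines : ∀ {b c a} → Intertwines[ suc n ] b c a → b [] ≡ false → c [] ≡ τ →
                   ∀ x → Intertwines[ n ] (sect b x) (sect c x) (sect a (τ xor x))
sect-intertwines {n} {b = b} {c} {a} (intertwines bc≈ca) b₀ c₀ x = intertwines (begin
  sect b x · sect c x   ≈⟨ sect-· b c b₀ x ⟨
  sect (b · c) x        ≈⟨ ≈[]-sect bc≈ca x ⟩
  sect (c · a) x        ≈⟨ sect-· c a c₀ x ⟩
  sect c x · sect a _   ∎)
  where open ≈[]-Reasoning n

σ⁻¹≈σ : σ ⁻¹ ≈ σ
σ⁻¹≈σ []      = refl
σ⁻¹≈σ (_ ∷ _) = refl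

σ^_ : Bool → Ω
σ^ τ = ⟨ e , e ⟩ τ

σ-intertwines-σ^ : ∀ τ → Intertwines[ n ] σ (σ^ τ) σ
σ-intertwines-σ^ {zero}  τ = intertwines leaf
σ-intertwines-σ^ {suc n} τ = intertwines (node (xor-comm true τ) sections)
  where
  sections : ∀ x → sect (σ · σ^ τ) x ≈[ n ] sect (σ^ τ · σ) x
  sections false = ≈[]-refl
  sections true  = ≈[]-refl

diagonal : Ω → Ω
diagonal X = ⟨ X , X ⟩ false

sect-diagonal : ∀ X x → sect (diagonal X) x ≈[ n ] X
sect-diagonal X false = ≈[]-refl
sect-diagonal X true  = ≈[]-refl

diagonal-cong : ∀ {X Y} → X ≈[ n ] Y → diagonal X ≈[ suc n ] diagonal Y
diagonal-cong X≈Y = node refl (λ { false → X≈Y ; true → X≈Y })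

diagonal-intertwines : ∀ {b a X} → b [] ≡ a [] → (∀ x → Intertwines[ n ] (sect b x) X (sect a x)) →
                       Intertwines[ suc n ] b (diagonal X) a
diagonal-intertwines {n} {b} {a} {X} b₀≡a₀ sections =
  intertwines (node (≡.trans (xor-identityʳ (b [])) b₀≡a₀) λ x → begin
    sect b x · sect (diagonal X) (b [] xor x)   ≈⟨ ·-congˡ (sect b x) (sect-diagonal X (b [] xor x)) ⟩
    sect b x · X                                ≈⟨ equation (sections x) ⟩
    X · sect a x                                ≈⟨ ·-congʳ (sect a x) (sect-diagonal X x) ⟨
    sect (diagonal X) x · sect a x              ∎)
  where open ≈[]-Reasoning n

σ-intertwines-diagonal : ∀ X → Intertwines[ n ] σ (diagonal X) σ
σ-intertwines-diagonal {zero}  X = intertwines leaf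
σ-intertwines-diagonal {suc n} X = diagonal-intertwines refl (λ _ → intertwines-ε X)

limit : (ℕ → Ω) → Ω
limit f v = f (suc (length v)) v

limit-≈[] : ∀ {f} → (∀ {k m} → k ≤ m → f m ≈[ k ] f k) → ∀ n → limit f ≈[ n ] f n
limit-≈[] stable n =
  pointwise⇒≈[] (λ v |v|<n → ≡.sym (≈[]⇒pointwise (stable |v|<n) v ≤-refl))

ε-inClosedSubgroup : ∀ gens → InClosedSubgroup gens e
ε-inClosedSubgroup gens n = [] , λ _ _ → refl

evalWord-intertwines : ∀ {gens′ β gens} → (∀ i → Intertwines[ n ] (gens′ i) β (gens i)) →
                       ∀ w → Intertwines[ n ] (evalWord gens′ w) β (evalWord gens w)
evalWord-intertwines {β = β} gens≈ []                = intertwines-ε β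
evalWord-intertwines         gens≈ ((i , false) ∷ w) =
  intertwines-∙ (gens≈ i) (evalWord-intertwines gens≈ w)
evalWord-intertwines         gens≈ ((i , true)  ∷ w) =
  intertwines-∙ (intertwines-⁻¹ (gens≈ i)) (evalWord-intertwines gens≈ w)

inClosedSubgroup-map : ∀ {gens x gens′ x′} →
                       (∀ {n} w → evalWord gens w ≈[ n ] x → evalWord gens′ w ≈[ n ] x′) →
                       InClosedSubgroup gens x → InClosedSubgroup gens′ x′
inClosedSubgroup-map f x∈ n with x∈ n
... | w , w≈x = w , ≈[]⇒pointwise (f w (pointwise⇒≈[] w≈x))

inClosedSubgroup-conj : ∀ {gens′ β gens} → (∀ {n} i → Intertwines[ n ] (gens′ i) β (gens i)) →
                        ∀ x → InClosedSubgroup gens′ x ⇔ InClosedSubgroup gens (β ⁻¹ · x · β)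
inClosedSubgroup-conj {gens′} {β} {gens} gens≈ x =
  mk⇔ (inClosedSubgroup-map to) (inClosedSubgroup-map from)
  where
  to : ∀ {n} w → evalWord gens′ w ≈[ n ] x → evalWord gens w ≈[ n ] β ⁻¹ · x · β
  to w w≈x = intertwines-uniqueʳ (intertwines-respˡ w≈x (evalWord-intertwines gens≈ w))
                                 (intertwines-conj x β)
  from : ∀ {n} w → evalWord gens w ≈[ n ] β ⁻¹ · x · β → evalWord gens′ w ≈[ n ] x
  from w w≈x = intertwines-uniqueˡ (evalWord-intertwines gens≈ w)
                                   (intertwines-respʳ (≈[]-sym w≈x) (intertwines-conj x β))

module Descent (a₁ a₂ a₃ : Ω)
               (a₁≈ : a₁ ≈ σ) (a₂≈ : a₂ ≈ ⟨ a₃ ⁻¹ , a₂ ⁻¹ ⟩ true) (a₃≈ : a₃ ≈ ⟨ a₂ , a₃ ⟩ false) where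

  a : Fin 3 → Ω
  a = triple a₁ a₂ a₃

  a₁≈σ : a₁ ≈[ n ] σ
  a₁≈σ = ≈⇒≈[] a₁≈

  a₂-root : a₂ [] ≡ true
  a₂-root = a₂≈ []

  a₃-root : a₃ [] ≡ false
  a₃-root = a₃≈ []

  a₂-sect-false : sect a₂ false ≈[ n ] a₃ ⁻¹
  a₂-sect-false = ≈⇒≈[] (λ w → a₂≈ (false ∷ w))

  a₂-sect-true : sect a₂ true ≈[ n ] a₂ ⁻¹
  a₂-sect-true = ≈⇒≈[] (λ w → a₂≈ (true ∷ w))

  a₃-sect-false : sect a₃ false ≈[ n ] a₂
  a₃-sect-false = ≈⇒≈[] (λ w → a₃≈ (false ∷ w))

  a₃-sect-true : sect a₃ true ≈[ n ] a₃
  a₃-sect-true = ≈⇒≈[] (λ w → a₃≈ (true ∷ w))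

  a₂a₃≈σ : a₂ · a₃ ≈[ n ] σ
  a₂a₃≈σ {zero}  = leaf
  a₂a₃≈σ {suc n} = node (cong₂ _xor_ a₂-root a₃-root) λ where
    false → ≈[]-trans (sect-· a₂ a₃ a₂-root false)
                      (≈[]-trans (·-cong a₂-sect-false a₃-sect-true) (⁻¹-inverseˡ a₃))
    true  → ≈[]-trans (sect-· a₂ a₃ a₂-root true)
                      (≈[]-trans (·-cong a₂-sect-true a₃-sect-false) (⁻¹-inverseˡ a₂))

  a₂-sect-product : sect a₂ false · sect a₂ true ≈[ n ] a₁
  a₂-sect-product {n} = begin
    sect a₂ false · sect a₂ true   ≈⟨ ·-cong a₂-sect-false a₂-sect-true ⟩
    a₃ ⁻¹ · a₂ ⁻¹                  ≈⟨ ⁻¹-anti-homo-∙ a₂ a₃ ⟨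
    (a₂ · a₃) ⁻¹                   ≈⟨ ⁻¹-cong a₂a₃≈σ ⟩
    σ ⁻¹                           ≈⟨ ≈⇒≈[] σ⁻¹≈σ ⟩
    σ                              ≈⟨ a₁≈σ ⟨
    a₁                             ∎
    where open ≈[]-Reasoning n

  -- If the conjugator of a₂ swaps at the root, the sections of a₂ come in the order
  -- a₂⁻¹a₃⁻¹, which is conjugate to a₁ by a₂⁻¹.
  untwist : Bool → Ω
  untwist false = e
  untwist true  = sect a₂ true

  untwist-intertwines : ∀ τ → Intertwines[ n ] (sect (a₂ · a₂) (τ xor false)) (untwist τ) a₁
  untwist-intertwines false = intertwines-respʳ a₂-sect-product
    (intertwines-respˡ (≈[]-sym (sect-· a₂ a₂ a₂-root false)) (intertwines-refl _))
  untwist-intertwines true  = intertwines-respʳ a₂-sect-product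
    (intertwines-respˡ (≈[]-sym (sect-· a₂ a₂ a₂-root true))
      (intertwines-swap (sect a₂ true) (sect a₂ false)))

  record ConjugateTriple : Set where
    field
      b c           : Fin 3 → Ω
      intertwines-a : ∀ {n} i → Intertwines[ n ] (b i) (c i) (a i)
      product≈e     : ∀ {n} → b (# 0) · b (# 1) · b (# 2) ≈[ n ] e

  open ConjugateTriple

  conjugateTriple : ∀ {b₁ b₂ b₃} → b₁ ∼ a₁ → b₂ ∼ a₂ → b₃ ∼ a₃ → b₁ · b₂ · b₃ ≈ e → ConjugateTriple
  conjugateTriple {b₁} {b₂} {b₃} (c₁ , b₁≈) (c₂ , b₂≈) (c₃ , b₃≈) b₁b₂b₃≈e = record
    { b             = triple b₁ b₂ b₃
    ; c             = triple c₁ c₂ c₃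
    ; intertwines-a = λ where
        zero             → conjugate⇒intertwines (≈⇒≈[] b₁≈)
        (suc zero)       → conjugate⇒intertwines (≈⇒≈[] b₂≈)
        (suc (suc zero)) → conjugate⇒intertwines (≈⇒≈[] b₃≈)
    ; product≈e     = ≈⇒≈[] b₁b₂b₃≈e
    }

  conjugateBy : Ω → ConjugateTriple → ConjugateTriple
  conjugateBy C t = record
    { b             = λ i → C ⁻¹ · b t i · C
    ; c             = λ i → C ⁻¹ · c t i
    ; intertwines-a = λ i → intertwines-trans (intertwines-sym (conj i)) (intertwines-a t i)
    ; product≈e     = intertwines-uniqueʳ
        (intertwines-respˡ (product≈e t)
          (intertwines-∙ (intertwines-∙ (conj (# 0)) (conj (# 1))) (conj (# 2))))
        (intertwines-ε C)
    }
    where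
    conj : ∀ {n} i → Intertwines[ n ] (b t i) C (C ⁻¹ · b t i · C)
    conj i = intertwines-conj (b t i) C

  -- σ^t commutes with σ, so this still conjugates σ to b₁, just as c₁ does.
  normaliser : ConjugateTriple → Ω
  normaliser t = c t (# 0) · σ^ (c t (# 0) [] xor c t (# 2) [])

  module Normalised (t : ConjugateTriple) where

    t̂ : ConjugateTriple
    t̂ = conjugateBy (normaliser t) t

    b₁≈σ : b t̂ (# 0) ≈[ n ] σ
    b₁≈σ = intertwines-uniqueʳ (intertwines-conj (b t (# 0)) (normaliser t))
      (intertwines-trans (intertwines-respʳ a₁≈σ (intertwines-a t (# 0))) (σ-intertwines-σ^ _))

    b₂-root : b t̂ (# 1) [] ≡ true
    b₂-root = ≡.trans (intertwines-root (intertwines-a t̂ (# 1))) a₂-root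

    b₃-root : b t̂ (# 2) [] ≡ false
    b₃-root = ≡.trans (intertwines-root (intertwines-a t̂ (# 2))) a₃-root

    c₃-root : c t̂ (# 2) [] ≡ false
    c₃-root = ≡.trans (cong (_xor c t (# 2) []) (xor-involutive (c t (# 0) []) (c t (# 2) [])))
                      (xor-same (c t (# 2) []))

    p q B₂ B₃ : Ω
    p  = sect (b t̂ (# 1)) false
    q  = sect (b t̂ (# 1)) true
    B₂ = sect (b t̂ (# 2)) false
    B₃ = sect (b t̂ (# 2)) true

    complementary-sections : ∀ x → sect (b t̂ (# 1)) (not x) · sect (b t̂ (# 2)) x ≈[ n ] e
    complementary-sections {n} x = begin
      sect b₂ (not x) · sect b₃ x       ≈⟨ ·-congʳ (sect b₃ x) (·-identityˡ (sect b₂ (not x))) ⟨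
      e · sect b₂ (not x) · sect b₃ x   ≈⟨ sect-· (σ · b₂) b₃ (cong (true xor_) b₂-root) x ⟨
      sect (σ · b₂ · b₃) x              ≈⟨ ≈[]-sect σb₂b₃≈e x ⟩
      e                                 ∎
      where
      open ≈[]-Reasoning n
      b₂ = b t̂ (# 1)
      b₃ = b t̂ (# 2)
      σb₂b₃≈e : σ · b₂ · b₃ ≈[ suc n ] e
      σb₂b₃≈e = ≈[]-trans (·-congʳ b₃ (·-congʳ b₂ (≈[]-sym b₁≈σ))) (product≈e t̂)

    product-descends : p · q · B₂ · B₃ ≈[ n ] e
    product-descends {n} = begin
      p · q · B₂ · B₃     ≈⟨ ·-congʳ B₃ (·-assoc p q B₂) ⟩
      p · (q · B₂) · B₃   ≈⟨ ·-congʳ B₃ (·-congˡ p (complementary-sections false)) ⟩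
      p · e · B₃          ≈⟨ ·-congʳ B₃ (·-identityʳ p) ⟩
      p · B₃              ≈⟨ complementary-sections true ⟩
      e                   ∎
      where open ≈[]-Reasoning n

    -- pq is the first section of b₂², which does not swap at the root.
    pq-intertwines : Intertwines[ n ] (p · q) (sect (c t̂ (# 1)) false) (sect (a₂ · a₂) (c t̂ (# 1) [] xor false))
    pq-intertwines = intertwines-respˡ (sect-· b₂ b₂ b₂-root false)
      (sect-intertwines (intertwines-∙ b₂-intertwines b₂-intertwines) (xor-same (b₂ [])) refl false)
      where
      b₂ = b t̂ (# 1)
      b₂-intertwines = intertwines-a t̂ (# 1)

    descendant : ConjugateTriple
    descendant = record
      { b             = triple (p · q) B₂ B₃
      ; c             = triple (sect c₂ false · untwist (c₂ [])) (sect c₃ false) (sect c₃ true)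
      ; intertwines-a = λ where
          zero             → intertwines-trans pq-intertwines (untwist-intertwines (c₂ []))
          (suc zero)       → intertwines-respʳ a₃-sect-false
                               (sect-intertwines (intertwines-a t̂ (# 2)) b₃-root c₃-root false)
          (suc (suc zero)) → intertwines-respʳ a₃-sect-true
                               (sect-intertwines (intertwines-a t̂ (# 2)) b₃-root c₃-root true)
      ; product≈e     = product-descends
      }
      where
      c₂ = c t̂ (# 1)
      c₃ = c t̂ (# 2)

    lift-intertwines : ∀ {X} → (∀ i → Intertwines[ n ] (b descendant i) X (a i)) →
                       ∀ i → Intertwines[ suc n ] (b t̂ i) (diagonal X) (a i)
    lift-intertwines {X = X} X-intertwines zero =
      intertwines-respʳ (≈[]-sym a₁≈σ) (intertwines-respˡ (≈[]-sym b₁≈σ) (σ-intertwines-diagonal X))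
    lift-intertwines X-intertwines (suc zero) =
      diagonal-intertwines (intertwines-root (intertwines-a t̂ (# 1))) λ where
        false → intertwines-respʳ (≈[]-sym a₂-sect-false)
                  (intertwines-respˡ (≈[]-sym (inverseˡ-unique p B₃ (complementary-sections true)))
                    (intertwines-⁻¹ (X-intertwines (# 2))))
        true  → intertwines-respʳ (≈[]-sym a₂-sect-true)
                  (intertwines-respˡ (≈[]-sym (inverseˡ-unique q B₂ (complementary-sections false)))
                    (intertwines-⁻¹ (X-intertwines (# 1))))
    lift-intertwines X-intertwines (suc (suc zero)) =
      diagonal-intertwines (intertwines-root (intertwines-a t̂ (# 2))) λ where
        false → intertwines-respʳ (≈[]-sym a₃-sect-false) (X-intertwines (# 1))
        true  → intertwines-respʳ (≈[]-sym a₃-sect-true) (X-intertwines (# 2))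

  open Normalised using (descendant; lift-intertwines)

  conjugatorApprox : ℕ → ConjugateTriple → Ω
  conjugatorApprox zero    t = e
  conjugatorApprox (suc n) t = normaliser t · diagonal (conjugatorApprox n (descendant t))

  conjugatorApprox-intertwines : ∀ n t i → Intertwines[ n ] (b t i) (conjugatorApprox n t) (a i)
  conjugatorApprox-intertwines zero    t i = intertwines leaf
  conjugatorApprox-intertwines (suc n) t i =
    intertwines-trans (intertwines-conj (b t i) (normaliser t))
                      (lift-intertwines t (conjugatorApprox-intertwines n (descendant t)) i)

  conjugatorApprox-stable : ∀ {k m} t → k ≤ m → conjugatorApprox m t ≈[ k ] conjugatorApprox k t
  conjugatorApprox-stable t z≤n       = leaf
  conjugatorApprox-stable t (s≤s k≤m) =
    ·-congˡ (normaliser t) (diagonal-cong (conjugatorApprox-stable (descendant t) k≤m))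

  conjugator : ConjugateTriple → Ω
  conjugator t = limit (λ n → conjugatorApprox n t)

  conjugator-intertwines : ∀ t i → Intertwines[ n ] (b t i) (conjugator t) (a i)
  conjugator-intertwines {n} t i = intertwines-respᶜ
    (≈[]-sym (limit-≈[] (conjugatorApprox-stable t) n)) (conjugatorApprox-intertwines n t i)

theorem3p2 : ∀ (a₁ a₂ a₃ : Ω)
    → a₁ ≈ σ
    → a₂ ≈ ⟨ a₃ ⁻¹ , a₂ ⁻¹ ⟩ true
    → a₃ ≈ ⟨ a₂ , a₃ ⟩ false
    → ∀ (b₁ b₂ b₃ : Ω)
    → b₁ ∼ a₁ → b₂ ∼ a₂ → b₃ ∼ a₃
    → b₁ · b₂ · b₃ ≈ e
    → (∃ λ (β : Ω) → ∃ λ (g₁ : Ω) → ∃ λ (g₂ : Ω) → ∃ λ (g₃ : Ω)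
         → InClosedSubgroup (triple a₁ a₂ a₃) g₁
         × InClosedSubgroup (triple a₁ a₂ a₃) g₂
         × InClosedSubgroup (triple a₁ a₂ a₃) g₃
         × b₁ ≈ β · g₁ · a₁ · g₁ ⁻¹ · β ⁻¹
         × b₂ ≈ β · g₂ · a₂ · g₂ ⁻¹ · β ⁻¹
         × b₃ ≈ β · g₃ · a₃ · g₃ ⁻¹ · β ⁻¹)
      × (∃ λ (γ : Ω) → ∀ (x : Ω)
         → InClosedSubgroup (triple b₁ b₂ b₃) x
           ⇔ InClosedSubgroup (triple a₁ a₂ a₃) (γ ⁻¹ · x · γ))
theorem3p2 a₁ a₂ a₃ a₁≈ a₂≈ a₃≈ b₁ b₂ b₃ b₁∼a₁ b₂∼a₂ b₃∼a₃ b₁b₂b₃≈e =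
  (β , e , e , e , ε∈G , ε∈G , ε∈G , conjugates (# 0) , conjugates (# 1) , conjugates (# 2)) ,
  (β , inClosedSubgroup-conj (conjugator-intertwines t))
  where
  open Descent a₁ a₂ a₃ a₁≈ a₂≈ a₃≈

  t : ConjugateTriple
  t = conjugateTriple b₁∼a₁ b₂∼a₂ b₃∼a₃ b₁b₂b₃≈e

  β : Ω
  β = conjugator t

  ε∈G : InClosedSubgroup a e
  ε∈G = ε-inClosedSubgroup a

  unpad : ∀ {n} x y → x · e · y · e ⁻¹ · x ⁻¹ ≈[ n ] x · y · x ⁻¹
  unpad x y = ·-congʳ (x ⁻¹)
    (≈[]-trans (·-congʳ (e ⁻¹) (·-congʳ y (·-identityʳ x))) (·-identityʳ (x · y)))

  conjugates : ∀ i → triple b₁ b₂ b₃ i ≈ β · e · a i · e ⁻¹ · β ⁻¹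
  conjugates i = ≈[]⇒≈
    (≈[]-trans (intertwines⇒conjugate (conjugator-intertwines t i)) (≈[]-sym (unpad β (a i))))
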